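{- Let $G$ be a graph on $n\ge2$ vertices such that neither $G$ nor its complement $\overline{G}$ has isolated vertices or connected components isomorphic to $K_2$. Then $$2(n-1)\ge \gamma_t(M(G))+\gamma_t(M(\overline{G}))\ge 2\left\lceil\frac{2n}{3}\right\rceil$$ and $$(n-1)^2\ge \gamma_t(M(G))\cdot\gamma_t(M(\overline{G}))\ge \left(\left\lceil\frac{2n}{3}\right\rceil\right)^2.$$
   Context: All graphs are finite and simple. $\overline{G}$ is the complement of $G$: same vertex set, with two distinct vertices adjacent iff they are not adjacent in $G$. For a graph $H$ with no isolated vertices, a total dominating set of $H$ is a set $S\subseteq V(H)$ such that every vertex of $H$ has at least one neighbor in $S$; $\gamma_t(H)$ is the minimum cardinality of a total dominating set. The middle graph $M(G)$ of a graph $G$ has vertex set $V(G)\cup E(G)$ (disjoint union), and two of its vertices $x,y$ are adjacent exactly when either $x,y\in E(G)$ are edges of $G$ sharing a common endpoint, or $x\in V(G)$, $y\in E(G)$ and $x$ is an endpoint of $y$ (no two elements of $V(G)$ are adjacent in $M(G)$). -}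

module Defs where

open import Data.Nat using (ℕ; _<_)
open import Data.Bool using (Bool; true; false; not; _∧_)
import Data.Bool.Properties
import Data.Empty
import Data.Nat
open import Data.Fin using (Fin; toℕ)
open import Data.Fin.Properties using (_≟_)
open import Data.Sum using (_⊎_; inj₁; inj₂)
open import Data.Product using (Σ; Σ-syntax; ∃; ∃-syntax; _×_; _,_; proj₁; proj₂)
open import Data.List using (List; length)
open import Data.List.Membership.Propositional using (_∈_)
open import Data.List.Relation.Unary.Unique.Propositional using (Unique)
open import Data.Empty using (⊥)
open import Relation.Nullary using (¬_)
open import Relation.Nullary.Decidable using (⌊_⌋)
open import Relation.Binary.PropositionalEquality using (_≡_; _≢_)

record Graph (n : ℕ) : Set where
  field
    adj    : Fin n → Fin n → Bool
    adj-sym    : ∀ i j → adj i j ≡ adj j i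
    adj-irrefl : ∀ i → adj i i ≡ false
open Graph public

complement : ∀ {n} → Graph n → Graph n
complement {n} G = record
  { adj    = λ i j → not (adj G i j) ∧ not ⌊ i ≟ j ⌋
  ; adj-sym    = symc
  ; adj-irrefl = irc }
  where
  open import Relation.Binary.PropositionalEquality using (refl; sym; cong₂; cong)
  open import Relation.Nullary using (yes; no)
  eqsym : ∀ (i j : Fin n) → ⌊ i ≟ j ⌋ ≡ ⌊ j ≟ i ⌋
  eqsym i j with i ≟ j | j ≟ i
  ... | yes _ | yes _ = refl
  ... | no _  | no _  = refl
  ... | yes p | no q  = Data.Empty.⊥-elim (q (sym p))
  ... | no p  | yes q = Data.Empty.⊥-elim (p (sym q))
  symc : ∀ i j → (not (adj G i j) ∧ not ⌊ i ≟ j ⌋) ≡ (not (adj G j i) ∧ not ⌊ j ≟ i ⌋)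
  symc i j = cong₂ (λ a b → not a ∧ not b) (Graph.adj-sym G i j) (eqsym i j)
  irc : ∀ i → (not (adj G i i) ∧ not ⌊ i ≟ i ⌋) ≡ false
  irc i with i ≟ i
  ... | yes _ = Data.Bool.Properties.∧-zeroʳ (not (adj G i i))
  ... | no ¬p = Data.Empty.⊥-elim (¬p refl)

IsolatedVertex : ∀ {n} → Graph n → Fin n → Set
IsolatedVertex G v = ∀ u → adj G v u ≡ false

K2Component : ∀ {n} → Graph n → Fin n → Fin n → Set
K2Component G u v =
  adj G u v ≡ true
  × (∀ w → adj G u w ≡ true → w ≡ v)
  × (∀ w → adj G v w ≡ true → w ≡ u)

HasIsolatedVertex : ∀ {n} → Graph n → Set
HasIsolatedVertex G = ∃[ v ] IsolatedVertex G v

HasK2Component : ∀ {n} → Graph n → Set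
HasK2Component G = ∃[ u ] ∃[ v ] K2Component G u v

Edge : ∀ {n} → Graph n → Set
Edge {n} G = Σ[ p ∈ Fin n × Fin n ] (toℕ (proj₁ p) < toℕ (proj₂ p) × adj G (proj₁ p) (proj₂ p) ≡ true)

endpoint : ∀ {n} (G : Graph n) → Fin n → Edge G → Set
endpoint G v ((i , j) , _) = (v ≡ i) ⊎ (v ≡ j)

shareEndpoint : ∀ {n} (G : Graph n) → Edge G → Edge G → Set
shareEndpoint {n} G e f = ∃[ v ] (endpoint G v e × endpoint G v f)

record SGraph : Set₁ where
  field
    V   : Set
    Adj : V → V → Set
open SGraph public

middle : ∀ {n} → Graph n → SGraph
middle {n} G = record { V = Fin n ⊎ Edge G ; Adj = madj }
  where
  madj : Fin n ⊎ Edge G → Fin n ⊎ Edge G → Set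
  madj (inj₁ _) (inj₁ _) = ⊥
  madj (inj₁ v) (inj₂ e) = endpoint G v e
  madj (inj₂ e) (inj₁ v) = endpoint G v e
  madj (inj₂ e) (inj₂ f) = e ≢ f × shareEndpoint G e f

IsTDS : (H : SGraph) → List (V H) → Set
IsTDS H S = Unique S × (∀ x → ∃[ y ] (y ∈ S × Adj H x y))

IsγT : (H : SGraph) → ℕ → Set
IsγT H k = (∃[ S ] (IsTDS H S × length S ≡ k))
         × (∀ S → IsTDS H S → k Data.Nat.≤ length S)

-- Applied to G and to its complement, it suffices to show ⌈2n/3⌉ ≤ γ_t(M(G)) ≤ n − 1 for a graph G
-- on n ≥ 1 vertices without isolated vertices or K₂-components.
--
-- Lower bound: a total dominating set S of M(G) contains, for every vertex v, an edge pick v at v.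
-- Give every element of S three slots. Vertex v takes its own side of pick v and the third slot of
-- pick v, except that when both endpoints picked the same edge, the second endpoint takes instead a
-- slot of an element of S dominating that edge, labelled by the vertex through which it dominates.
-- This injects two copies of V(G) into the slots, so 2n ≤ 3|S|.
--
-- Upper bound: let every vertex v point to a neighbour next v. The edges {v, next v} dominate all of
-- M(G) except the edges forming a 2-cycle of next into which no other vertex points. Such a bare
-- 2-cycle is broken by redirecting one of its vertices to another neighbour, which exists because
-- the 2-cycle is not a K₂-component; the partner left behind feeds any 2-cycle this creates.
-- Arranging, for a vertex r with two neighbours p and q, that r ↔ p is a 2-cycle fed by q, the
-- out-edges of r and p coincide, which leaves at most n − 1 distinct edges.

module Submission where

open import Defs
open import Data.Nat using (ℕ; _≤_; _+_; _*_; _∸_)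
open import Data.Nat.DivMod using (_/_)
open import Data.Product using (∃-syntax; _×_)
open import Relation.Nullary using (¬_)

open import Axiom.UniquenessOfIdentityProofs using (module Decidable⇒UIP)
open import Data.Bool using (true)
import Data.Bool.Properties as Bool
open import Data.Empty using (⊥; ⊥-elim)
open import Data.Fin using (Fin; toℕ; punchIn; punchOut; remQuot; combine)
open import Data.Fin.Patterns using (0F; 1F; 2F)
import Data.Fin.Properties as Fin
open import Data.Fin.Properties using (combine-injective)
open import Data.List
  using (List; []; _∷_; _++_; length; map; concatMap; allFin; deduplicate; cartesianProduct)
open import Data.List.Properties using (length-map; length-tabulate; length-deduplicate)
open import Data.List.Membership.Propositional using (_∈_; find; lose)
open import Data.List.Membership.Propositional.Properties
  using (∈-map⁺; ∈-concatMap⁺; ∈-allFin; ∈-deduplicate⁺; ∈-cartesianProduct⁺; ∈-++⁺ˡ; ∈-++⁺ʳ)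
import Data.List.Membership.Setoid.Properties as SetoidMembership
open import Data.List.Relation.Unary.All as All using (all?)
open import Data.List.Relation.Unary.Any using (here; there; any?; index)
open import Data.List.Relation.Unary.Unique.Propositional using (Unique)
import Data.List.Relation.Unary.Unique.Propositional.Properties as Unique
import Data.List.Relation.Unary.Unique.DecPropositional.Properties as UniqueDec
open import Data.Nat using (zero; suc; _<_)
import Data.Nat.Properties as ℕ
open import Data.Nat.Induction using (<-rec)
open import Data.Nat.DivMod using (m<n*o⇒m/o<n)
open import Data.Product using (Σ; Σ-syntax; ∃; _,_; proj₁; proj₂)
open import Data.Product.Properties using (≡-dec)
open import Data.Sum using (_⊎_; inj₁; inj₂; [_,_]; swap)
import Data.Sum.Properties as Sum
open import Function using (_∘_)
open import Function.Bundles using (Injection)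
open import Function.Definitions using (Injective)
open import Function.Properties.Inverse using (↔⇒↣)
open import Relation.Binary.Definitions using (DecidableEquality; tri<; tri≈; tri>)
open import Relation.Binary.PropositionalEquality hiding ([_])
open import Relation.Nullary using (Dec; yes; no)
open import Relation.Nullary.Decidable using (_×-dec_; _⊎-dec_; _→-dec_; ¬?)
import Relation.Nullary.Decidable as Dec
import Relation.Unary as U

module _ {P : ℕ → Set} (P? : U.Decidable P) where

  least-satisfying : ∀ m → P m → ∃[ k ] (P k × ∀ j → P j → k ≤ j)
  least-satisfying = <-rec _ search
    where
    search : ∀ m → (∀ {j} → j < m → P j → ∃[ k ] (P k × ∀ j → P j → k ≤ j))
           → P m → ∃[ k ] (P k × ∀ j → P j → k ≤ j)
    search m below pm with ℕ.anyUpTo? P? m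
    ... | yes (j , j<m , pj) = below j<m pj
    ... | no none = m , pm , λ j pj → ℕ.≮⇒≥ (λ j<m → none (j , j<m , pj))

module _ {A : Set} where

  tuples : List A → ℕ → List (List A)
  tuples xs zero    = [] ∷ []
  tuples xs (suc k) = concatMap (λ x → map (x ∷_) (tuples xs k)) xs

  ∈-tuples : ∀ {xs} → (∀ x → x ∈ xs) → ∀ ys → ys ∈ tuples xs (length ys)
  ∈-tuples ∈-xs []       = here refl
  ∈-tuples ∈-xs (y ∷ ys) = ∈-concatMap⁺ _ (lose (∈-xs y) (∈-map⁺ (y ∷_) (∈-tuples ∈-xs ys)))

  module _ {P : A → Set} (P? : U.Decidable P) (P-irrelevant : ∀ {x} (p q : P x) → p ≡ q) where

    witnesses : List A → List (Σ A P)
    witnesses []       = []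
    witnesses (x ∷ xs) with P? x
    ... | yes px = (x , px) ∷ witnesses xs
    ... | no _   = witnesses xs

    ∈-witnesses : ∀ {x xs} → x ∈ xs → (px : P x) → (x , px) ∈ witnesses xs
    ∈-witnesses {xs = y ∷ xs} x∈ px with P? y | x∈
    ... | yes py | here refl  = here (cong (_ ,_) (P-irrelevant px py))
    ... | yes py | there x∈xs = there (∈-witnesses x∈xs px)
    ... | no ¬py | here refl  = ⊥-elim (¬py px)
    ... | no ¬py | there x∈xs = ∈-witnesses x∈xs px

  injection-into-slots⇒≤ : ∀ {m k} (xs : List A) (f : Fin m → A × Fin k) → Injective _≡_ _≡_ f
    → (∀ i → proj₁ (f i) ∈ xs) → m ≤ k * length xs
  injection-into-slots⇒≤ {m} {k} xs f f-injective f∈xs = Fin.injective⇒≤ code-injective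
    where
    code : Fin m → Fin (k * length xs)
    code i = combine (proj₂ (f i)) (index (f∈xs i))
    code-injective : Injective _≡_ _≡_ code
    code-injective {i} {j} eq with combine-injective _ _ _ _ eq
    ... | same-tag , same-index = f-injective
      (cong₂ _,_ (SetoidMembership.index-injective (setoid A) (f∈xs i) (f∈xs j) same-index) same-tag)

module FiniteTotalDomination (H : SGraph) (_≟_ : DecidableEquality (V H))
  (Adj? : ∀ x y → Dec (Adj H x y)) (vertices : List (V H)) (∈-vertices : ∀ x → x ∈ vertices) where

  open import Data.List.Relation.Unary.Unique.DecPropositional _≟_ using (unique?)

  isTDS? : U.Decidable (IsTDS H)
  isTDS? S = unique? S ×-dec dominates?
    where
    dominates? : Dec (∀ x → ∃[ y ] (y ∈ S × Adj H x y))
    dominates? with all? (λ x → any? (Adj? x) S) vertices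
    ... | yes all = yes λ x → find (All.lookup all (∈-vertices x))
    ... | no ¬all = no λ dom →
      ¬all (All.tabulate λ {x} _ → let _ , y∈S , xy = dom x in lose y∈S xy)

  TDS-of-size : ℕ → Set
  TDS-of-size k = ∃[ S ] (IsTDS H S × length S ≡ k)

  TDS-of-size? : U.Decidable TDS-of-size
  TDS-of-size? k with any? (λ S → isTDS? S ×-dec (length S ℕ.≟ k)) (tuples vertices k)
  ... | yes found = let S , _ , tds , size = find found in yes (S , tds , size)
  ... | no none   = no λ { (S , tds , refl) → none (lose (∈-tuples ∈-vertices S) (tds , refl)) }

  γT-exists : ∀ {S} → IsTDS H S → ∃[ k ] (IsγT H k × k ≤ length S)
  γT-exists {S} tds with least-satisfying TDS-of-size? (length S) (S , tds , refl)
  ... | k , tds-k , minimal =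
    k , (tds-k , λ S′ tds′ → minimal _ (S′ , tds′ , refl)) , minimal _ (S , tds , refl)

module Edges {n : ℕ} (G : Graph n) where

  IsEdge : Fin n × Fin n → Set
  IsEdge p = toℕ (proj₁ p) < toℕ (proj₂ p) × adj G (proj₁ p) (proj₂ p) ≡ true

  isEdge? : U.Decidable IsEdge
  isEdge? p = (toℕ (proj₁ p) ℕ.<? toℕ (proj₂ p)) ×-dec (adj G (proj₁ p) (proj₂ p) Bool.≟ true)

  IsEdge-irrelevant : ∀ {p} (a b : IsEdge p) → a ≡ b
  IsEdge-irrelevant (lt , uv) (lt′ , uv′) =
    cong₂ _,_ (ℕ.<-irrelevant lt lt′) (Decidable⇒UIP.≡-irrelevant Bool._≟_ uv uv′)

  Edge-≡ : {e e′ : Edge G} → proj₁ e ≡ proj₁ e′ → e ≡ e′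
  Edge-≡ {p , a} {.p , b} refl = cong (p ,_) (IsEdge-irrelevant a b)

  _≟ₑ_ : DecidableEquality (Edge G)
  e ≟ₑ e′ = Dec.map′ Edge-≡ (cong proj₁) (≡-dec Fin._≟_ Fin._≟_ (proj₁ e) (proj₁ e′))

  edges : List (Edge G)
  edges = witnesses isEdge? IsEdge-irrelevant (cartesianProduct (allFin n) (allFin n))

  ∈-edges : ∀ e → e ∈ edges
  ∈-edges ((i , j) , ij) =
    ∈-witnesses isEdge? IsEdge-irrelevant (∈-cartesianProduct⁺ (∈-allFin i) (∈-allFin j)) ij

  endpoint? : ∀ w e → Dec (endpoint G w e)
  endpoint? w ((i , j) , _) = (w Fin.≟ i) ⊎-dec (w Fin.≟ j)

  shareEndpoint? : ∀ e f → Dec (shareEndpoint G e f)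
  shareEndpoint? e f = Fin.any? (λ w → endpoint? w e ×-dec endpoint? w f)

  middle-adj? : ∀ x y → Dec (Adj (middle G) x y)
  middle-adj? (inj₁ _) (inj₁ _) = no λ ()
  middle-adj? (inj₁ v) (inj₂ e) = endpoint? v e
  middle-adj? (inj₂ e) (inj₁ v) = endpoint? v e
  middle-adj? (inj₂ e) (inj₂ f) = ¬? (e ≟ₑ f) ×-dec shareEndpoint? e f

  middle-vertices : List (V (middle G))
  middle-vertices = map inj₁ (allFin n) ++ map inj₂ edges

  ∈-middle-vertices : ∀ x → x ∈ middle-vertices
  ∈-middle-vertices (inj₁ v) = ∈-++⁺ˡ (∈-map⁺ inj₁ (∈-allFin v))
  ∈-middle-vertices (inj₂ e) = ∈-++⁺ʳ (map inj₁ (allFin n)) (∈-map⁺ inj₂ (∈-edges e))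

  open FiniteTotalDomination (middle G) (Sum.≡-dec Fin._≟_ _≟ₑ_) middle-adj?
    middle-vertices ∈-middle-vertices public using (γT-exists)

  adj⇒≢ : ∀ {u v} → adj G u v ≡ true → u ≢ v
  adj⇒≢ {u} uv refl with trans (sym uv) (adj-irrefl G u)
  ... | ()

  sym-adj : ∀ {u v} → adj G u v ≡ true → adj G v u ≡ true
  sym-adj {u} {v} uv = trans (adj-sym G v u) uv

  endpoints-distinct : ∀ (e : Edge G) → proj₁ (proj₁ e) ≢ proj₂ (proj₁ e)
  endpoints-distinct (_ , i<j , _) i≡j = ℕ.<-irrefl (cong toℕ i≡j) i<j

  endpoint-of-two : ∀ {u v w} e → endpoint G u e → endpoint G v e → endpoint G w e → v ≢ w
    → u ≡ v ⊎ u ≡ w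
  endpoint-of-two _ (inj₁ refl) (inj₁ refl) _           _   = inj₁ refl
  endpoint-of-two _ (inj₂ refl) (inj₂ refl) _           _   = inj₁ refl
  endpoint-of-two _ (inj₁ refl) _           (inj₁ refl) _   = inj₂ refl
  endpoint-of-two _ (inj₂ refl) _           (inj₂ refl) _   = inj₂ refl
  endpoint-of-two _ (inj₁ refl) (inj₂ refl) (inj₂ refl) v≢w = ⊥-elim (v≢w refl)
  endpoint-of-two _ (inj₂ refl) (inj₁ refl) (inj₁ refl) v≢w = ⊥-elim (v≢w refl)

  edge-≡-by-endpoints : ∀ e e′ → (∀ w → endpoint G w e → endpoint G w e′) → e ≡ e′
  edge-≡-by-endpoints e@((i , j) , i<j , _) e′@((i′ , j′) , i′<j′ , _) ends⊆ =
    Edge-≡ (same-ends (ends⊆ i (inj₁ refl)) (ends⊆ j (inj₂ refl)))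
    where
    same-ends : i ≡ i′ ⊎ i ≡ j′ → j ≡ i′ ⊎ j ≡ j′ → (i , j) ≡ (i′ , j′)
    same-ends (inj₁ refl) (inj₂ refl) = refl
    same-ends (inj₁ refl) (inj₁ refl) = ⊥-elim (ℕ.<-irrefl refl i<j)
    same-ends (inj₂ refl) (inj₂ refl) = ⊥-elim (ℕ.<-irrefl refl i<j)
    same-ends (inj₂ refl) (inj₁ refl) = ⊥-elim (ℕ.<-asym i<j i′<j′)

  edge : ∀ u v → adj G u v ≡ true → Edge G
  edge u v uv with ℕ.<-cmp (toℕ u) (toℕ v)
  ... | tri< u<v _ _ = (u , v) , u<v , uv
  ... | tri≈ _ u≡v _ = ⊥-elim (adj⇒≢ uv (Fin.toℕ-injective u≡v))
  ... | tri> _ _ v<u = (v , u) , v<u , sym-adj uv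

  endpoint-edge⁺ : ∀ {w} u v uv → w ≡ u ⊎ w ≡ v → endpoint G w (edge u v uv)
  endpoint-edge⁺ u v uv w≡ with ℕ.<-cmp (toℕ u) (toℕ v)
  ... | tri< _ _ _   = w≡
  ... | tri≈ _ u≡v _ = ⊥-elim (adj⇒≢ uv (Fin.toℕ-injective u≡v))
  ... | tri> _ _ _   = swap w≡

  endpoint-edge⁻ : ∀ {w} u v uv → endpoint G w (edge u v uv) → w ≡ u ⊎ w ≡ v
  endpoint-edge⁻ u v uv w∈ with ℕ.<-cmp (toℕ u) (toℕ v)
  ... | tri< _ _ _   = w∈
  ... | tri≈ _ u≡v _ = ⊥-elim (adj⇒≢ uv (Fin.toℕ-injective u≡v))
  ... | tri> _ _ _   = swap w∈

module LowerBound {n : ℕ} (G : Graph n) (S : List (V (middle G)))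
  (dominating : ∀ x → ∃[ y ] (y ∈ S × Adj (middle G) x y)) where

  open Edges G

  Slot : Set
  Slot = V (middle G) × Fin 3

  side : Edge G → Fin n → Fin 3
  side ((i , _) , _) w with w Fin.≟ i
  ... | yes _ = 0F
  ... | no _  = 1F

  side≢2F : ∀ e w → side e w ≢ 2F
  side≢2F ((i , _) , _) w with w Fin.≟ i
  ... | yes _ = λ ()
  ... | no _  = λ ()

  side-injective : ∀ e {w w′} → endpoint G w e → endpoint G w′ e → side e w ≡ side e w′ → w ≡ w′
  side-injective ((i , _) , _) {w} {w′} w∈ w′∈ same with w Fin.≟ i | w′ Fin.≟ i
  ... | yes refl | yes refl = refl
  ... | no w≢i   | no w′≢i  with w∈ | w′∈
  ...   | inj₁ w≡i | _          = ⊥-elim (w≢i w≡i)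
  ...   | _        | inj₁ w′≡i  = ⊥-elim (w′≢i w′≡i)
  ...   | inj₂ refl | inj₂ refl = refl
  side-injective _ _ _ () | yes _ | no _
  side-injective _ _ _ () | no _  | yes _

  slot-≡ : ∀ {f f′ a b} → _≡_ {A = Slot} (inj₂ f , a) (inj₂ f′ , b) → f ≡ f′ × a ≡ b
  slot-≡ refl = refl , refl

  Labels : Fin n → Slot → Set
  Labels u s = s ≡ (inj₁ u , 0F) ⊎ ∃[ f ] (endpoint G u f × s ≡ (inj₂ f , side f u))

  Labels-injective : ∀ {u u′ s} → Labels u s → Labels u′ s → u ≡ u′
  Labels-injective (inj₁ refl) (inj₁ refl) = refl
  Labels-injective (inj₁ refl) (inj₂ (_ , _ , ()))
  Labels-injective (inj₂ (_ , _ , refl)) (inj₁ ())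
  Labels-injective (inj₂ (f , u∈f , refl)) (inj₂ (_ , u′∈f′ , eq)) with slot-≡ eq
  ... | refl , same-side = side-injective f u∈f u′∈f′ same-side

  Labels⇒tag≢2F : ∀ {u s} → Labels u s → proj₂ s ≢ 2F
  Labels⇒tag≢2F (inj₁ refl)                = λ ()
  Labels⇒tag≢2F {u} (inj₂ (f , _ , refl)) = side≢2F f u

  dominating-edge : ∀ v → Σ[ e ∈ Edge G ] (inj₂ e ∈ S × endpoint G v e)
  dominating-edge v with dominating (inj₁ v)
  ... | inj₂ e , e∈S , v∈e = e , e∈S , v∈e

  pick : Fin n → Edge G
  pick v = proj₁ (dominating-edge v)

  pick-∈ : ∀ v → inj₂ (pick v) ∈ S
  pick-∈ v = proj₁ (proj₂ (dominating-edge v))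

  endpoint-pick : ∀ v → endpoint G v (pick v)
  endpoint-pick v = proj₂ (proj₂ (dominating-edge v))

  Rescue : Edge G → Slot → Set
  Rescue e s = proj₁ s ∈ S × proj₁ s ≢ inj₂ e × ∃[ u ] (endpoint G u e × Labels u s)

  rescue : ∀ e → Σ Slot (Rescue e)
  rescue e with dominating (inj₂ e)
  ... | inj₁ u , u∈S , u∈e =
    (inj₁ u , 0F) , u∈S , (λ ()) , u , u∈e , inj₁ refl
  ... | inj₂ f , f∈S , e≢f , u , u∈e , u∈f =
    (inj₂ f , side f u) , f∈S , e≢f ∘ sym ∘ Sum.inj₂-injective , u , u∈e , inj₂ (f , u∈f , refl)

  Shared : Edge G → Set
  Shared e = ∀ u → endpoint G u e → pick u ≡ e

  shared? : U.Decidable Shared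
  shared? e = Fin.all? (λ u → endpoint? u e →-dec (pick u ≟ₑ e))

  Rescued : Fin n → Set
  Rescued v = Shared (pick v) × v ≡ proj₂ (proj₁ (pick v))

  rescued? : U.Decidable Rescued
  rescued? v = shared? (pick v) ×-dec (v Fin.≟ proj₂ (proj₁ (pick v)))

  rescued-of-two : ∀ {v v′} → pick v ≡ pick v′ → v ≢ v′ → Rescued v ⊎ Rescued v′
  rescued-of-two {v} {v′} same v≢v′ =
    [ (λ b≡v → inj₁ (shared , sym b≡v))
    , (λ b≡v′ → inj₂ (subst Shared same shared , trans (sym b≡v′) (cong (proj₂ ∘ proj₁) same))) ]
    (ends (proj₂ (proj₁ (pick v))) (inj₂ refl))
    where
    ends : ∀ u → endpoint G u (pick v) → u ≡ v ⊎ u ≡ v′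
    ends u u∈e = endpoint-of-two (pick v) u∈e (endpoint-pick v)
      (subst (endpoint G v′) (sym same) (endpoint-pick v′)) v≢v′
    shared : Shared (pick v)
    shared u u∈e = [ cong pick , (λ u≡v′ → trans (cong pick u≡v′) (sym same)) ] (ends u u∈e)

  baseSlot : Fin n → Slot
  baseSlot v = inj₂ (pick v) , side (pick v) v

  baseSlot-labels : ∀ v → Labels v (baseSlot v)
  baseSlot-labels v = inj₂ (pick v , endpoint-pick v , refl)

  extraSlot : ∀ v → Dec (Rescued v) → Slot
  extraSlot v (yes _) = proj₁ (rescue (pick v))
  extraSlot v (no _)  = inj₂ (pick v) , 2F

  extraSlot-∈ : ∀ v d → proj₁ (extraSlot v d) ∈ S
  extraSlot-∈ v (yes _) = proj₁ (proj₂ (rescue (pick v)))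
  extraSlot-∈ v (no _)  = pick-∈ v

  baseSlot≢extraSlot : ∀ v v′ d → baseSlot v ≢ extraSlot v′ d
  baseSlot≢extraSlot v v′ (no _) eq = Labels⇒tag≢2F (baseSlot-labels v) (cong proj₂ eq)
  baseSlot≢extraSlot v v′ (yes (shared , _)) eq with rescue (pick v′)
  ... | s , _ , s≢ , u , u∈e , labels =
    s≢ (trans (cong proj₁ (sym eq)) (cong inj₂ (trans (cong pick v≡u) (shared u u∈e))))
    where
    v≡u : v ≡ u
    v≡u = Labels-injective (baseSlot-labels v) (subst (Labels u) (sym eq) labels)

  extraSlot-injective : ∀ v v′ d d′ → extraSlot v d ≡ extraSlot v′ d′ → v ≡ v′
  extraSlot-injective v v′ (yes r) (yes r′) eq with rescue (pick v) | rescue (pick v′)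
  ... | _ , _ , _ , u , u∈e , labels | _ , _ , _ , u′ , u′∈e′ , labels′ =
    trans (proj₂ r) (trans (cong (proj₂ ∘ proj₁) same) (sym (proj₂ r′)))
    where
    same : pick v ≡ pick v′
    same = trans (sym (proj₁ r u u∈e))
      (trans (cong pick (Labels-injective labels (subst (Labels u′) (sym eq) labels′)))
             (proj₁ r′ u′ u′∈e′))
  extraSlot-injective v v′ (yes _) (no _) eq with rescue (pick v)
  ... | _ , _ , _ , _ , _ , labels = ⊥-elim (Labels⇒tag≢2F labels (cong proj₂ eq))
  extraSlot-injective v v′ (no _) (yes _) eq with rescue (pick v′)
  ... | _ , _ , _ , _ , _ , labels = ⊥-elim (Labels⇒tag≢2F labels (cong proj₂ (sym eq)))
  extraSlot-injective v v′ (no ¬r) (no ¬r′) eq with v Fin.≟ v′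
  ... | yes v≡v′ = v≡v′
  ... | no v≢v′  = ⊥-elim ([ ¬r , ¬r′ ] (rescued-of-two (proj₁ (slot-≡ eq)) v≢v′))

  slot : Fin 2 × Fin n → Slot
  slot (0F , v) = baseSlot v
  slot (1F , v) = extraSlot v (rescued? v)

  slot-injective : Injective _≡_ _≡_ slot
  slot-injective {0F , v} {0F , v′} eq =
    cong (0F ,_) (Labels-injective (baseSlot-labels v) (subst (Labels v′) (sym eq) (baseSlot-labels v′)))
  slot-injective {0F , v} {1F , v′} eq = ⊥-elim (baseSlot≢extraSlot v v′ (rescued? v′) eq)
  slot-injective {1F , v} {0F , v′} eq = ⊥-elim (baseSlot≢extraSlot v′ v (rescued? v) (sym eq))
  slot-injective {1F , v} {1F , v′} eq =
    cong (1F ,_) (extraSlot-injective v v′ (rescued? v) (rescued? v′) eq)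

  slot-∈ : ∀ x → proj₁ (slot x) ∈ S
  slot-∈ (0F , v) = pick-∈ v
  slot-∈ (1F , v) = extraSlot-∈ v (rescued? v)

  lower-bound : 2 * n ≤ 3 * length S
  lower-bound = injection-into-slots⇒≤ S (slot ∘ remQuot n)
    (λ eq → Injection.injective (↔⇒↣ (Fin.*↔× {2} {n})) (slot-injective eq)) (slot-∈ ∘ remQuot n)

module Neighbourhoods {n : ℕ} (G : Graph n) where

  open Edges G using (adj⇒≢)

  neighbour : ¬ HasIsolatedVertex G → ∀ v → ∃[ u ] (adj G v u ≡ true)
  neighbour no-isolated v with Fin.any? (λ u → adj G v u Bool.≟ true)
  ... | yes found = found
  ... | no none   = ⊥-elim (no-isolated (v , λ u → Bool.¬-not (λ vu → none (u , vu))))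

  NeighbourBesides : Fin n → Fin n → Set
  NeighbourBesides x y = ∃[ z ] (adj G x z ≡ true × z ≢ y)

  neighbourBesides? : ∀ x y → Dec (NeighbourBesides x y)
  neighbourBesides? x y = Fin.any? (λ z → (adj G x z Bool.≟ true) ×-dec ¬? (z Fin.≟ y))

  only-neighbour : ∀ {x y} → ¬ NeighbourBesides x y → ∀ z → adj G x z ≡ true → z ≡ y
  only-neighbour {x} {y} none z xz with z Fin.≟ y
  ... | yes z≡y = z≡y
  ... | no z≢y  = ⊥-elim (none (z , xz , z≢y))

  neighbour-besides : ¬ HasK2Component G → ∀ {x y} → adj G x y ≡ true
    → NeighbourBesides x y ⊎ NeighbourBesides y x
  neighbour-besides no-K2 {x} {y} xy with neighbourBesides? x y | neighbourBesides? y x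
  ... | yes found | _         = inj₁ found
  ... | no _      | yes found = inj₂ found
  ... | no none   | no none′  = ⊥-elim (no-K2 (x , y , xy , only-neighbour none , only-neighbour none′))

module Redirection {n : ℕ} (G : Graph n) (no-K2 : ¬ HasK2Component G)
  (choice : Fin n → Fin n) (choice-adj : ∀ v → adj G v (choice v) ≡ true) where

  open Edges G using (adj⇒≢)
  open Neighbourhoods G

  Feeds : (Fin n → Fin n) → Fin n → Fin n → Fin n → Set
  Feeds f x y w = w ≢ x × w ≢ y × (f w ≡ x ⊎ f w ≡ y)

  Fed : (Fin n → Fin n) → Fin n → Fin n → Set
  Fed f x y = ∃ (Feeds f x y)

  -- Unfolding these searches during conversion checking makes type checking very slow.
  opaque
    fed? : ∀ f x y → Dec (Fed f x y)
    fed? f x y = Fin.any? λ w →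
      ¬? (w Fin.≟ x) ×-dec ¬? (w Fin.≟ y) ×-dec ((f w Fin.≟ x) ⊎-dec (f w Fin.≟ y))

  Fed-sym : ∀ {f x y} → Fed f x y → Fed f y x
  Fed-sym (w , w≢x , w≢y , fw) = w , w≢y , w≢x , swap fw

  Redirectable : Fin n → Fin n → Set
  Redirectable x y = choice y ≡ x × ¬ Fed choice x y × NeighbourBesides x y
                   × (¬ NeighbourBesides y x ⊎ toℕ x < toℕ y)

  Redirects : Fin n → Set
  Redirects x = Redirectable x (choice x)

  opaque
    redirects? : U.Decidable Redirects
    redirects? x =
      (choice (choice x) Fin.≟ x) ×-dec ¬? (fed? choice x (choice x)) ×-dec neighbourBesides? x (choice x)
      ×-dec (¬? (neighbourBesides? (choice x) x) ⊎-dec (toℕ x ℕ.<? toℕ (choice x)))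

  next : Fin n → Fin n
  next x with redirects? x
  ... | yes (_ , _ , (z , _) , _) = z
  ... | no _                      = choice x

  next-spec : ∀ x → (Redirects x × adj G x (next x) ≡ true × next x ≢ choice x)
                  ⊎ (¬ Redirects x × next x ≡ choice x)
  next-spec x with redirects? x
  ... | yes R@(_ , _ , (_ , xz , z≢cx) , _) = inj₁ (R , xz , z≢cx)
  ... | no ¬R                               = inj₂ (¬R , refl)

  next-adj : ∀ x → adj G x (next x) ≡ true
  next-adj x with next-spec x
  ... | inj₁ (_ , xt , _) = xt
  ... | inj₂ (_ , unmoved) = subst (λ y → adj G x y ≡ true) (sym unmoved) (choice-adj x)

  ¬redirects⇒next≡choice : ∀ {x} → ¬ Redirects x → next x ≡ choice x
  ¬redirects⇒next≡choice {x} ¬R with next-spec x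
  ... | inj₁ (R , _)       = ⊥-elim (¬R R)
  ... | inj₂ (_ , unmoved) = unmoved

  fed⇒next≡choice : ∀ {x} → Fed choice x (choice x) → next x ≡ choice x
  fed⇒next≡choice fed = ¬redirects⇒next≡choice (λ R → proj₁ (proj₂ R) fed)

  redirects⇒¬redirects-choice : ∀ {x} → Redirects x → ¬ Redirects (choice x)
  redirects⇒¬redirects-choice {x} (ccx , _ , nb , tie) (_ , _ , nb′ , tie′) =
    asym tie (subst (λ y → ¬ NeighbourBesides y (choice x) ⊎ toℕ (choice x) < toℕ y) ccx tie′)
    where
    asym : ¬ NeighbourBesides (choice x) x ⊎ toℕ x < toℕ (choice x)
         → ¬ NeighbourBesides x (choice x) ⊎ toℕ (choice x) < toℕ x → ⊥
    asym (inj₁ none) _           = none (subst (NeighbourBesides (choice x)) ccx nb′)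
    asym _           (inj₁ none) = none nb
    asym (inj₂ lt)   (inj₂ gt)   = ℕ.<-asym lt gt

  redirects⇒fed : ∀ {x} → Redirects x → Fed next x (next x)
  redirects⇒fed {x} R with next-spec x
  ... | inj₂ (¬R , _)       = ⊥-elim (¬R R)
  ... | inj₁ (_ , _ , moved) =
    choice x , adj⇒≢ (choice-adj x) ∘ sym , moved ∘ sym
        , inj₁ (trans (¬redirects⇒next≡choice (redirects⇒¬redirects-choice R)) (proj₁ R))

  fed-by-choice⇒fed-by-next : ∀ {x y} → choice x ≡ y → choice y ≡ x → Fed choice x y → Fed next x y
  fed-by-choice⇒fed-by-next {x} {y} cx cy (w , w≢x , w≢y , cw∈) =
    w , w≢x , w≢y , subst (λ z → z ≡ x ⊎ z ≡ y) (sym (¬redirects⇒next≡choice ¬R)) cw∈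
    where
    ¬R : ¬ Redirects w
    ¬R (ccw , _) = [ (λ cw≡x → w≢y (trans (sym ccw) (trans (cong choice cw≡x) cx)))
                   , (λ cw≡y → w≢x (trans (sym ccw) (trans (cong choice cw≡y) cy))) ] cw∈

  bare-2-cycle-redirects : ∀ {x y} → choice x ≡ y → choice y ≡ x → ¬ Fed choice x y
    → Redirectable x y ⊎ Redirectable y x
  bare-2-cycle-redirects {x} {y} cx cy bare
    with neighbourBesides? x y | neighbourBesides? y x
  ... | yes nx | no ¬ny = inj₁ (cy , bare , nx , inj₁ ¬ny)
  ... | no ¬nx | yes ny = inj₂ (cx , bare ∘ Fed-sym , ny , inj₁ ¬nx)
  ... | no ¬nx | no ¬ny = ⊥-elim ([ ¬nx , ¬ny ] (neighbour-besides no-K2 xy))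
    where
    xy : adj G x y ≡ true
    xy = subst (λ z → adj G x z ≡ true) cx (choice-adj x)
  ... | yes nx | yes ny with ℕ.<-cmp (toℕ x) (toℕ y)
  ...   | tri< x<y _ _   = inj₁ (cy , bare , nx , inj₂ x<y)
  ...   | tri> _ _ y<x   = inj₂ (cx , bare ∘ Fed-sym , ny , inj₂ y<x)
  ...   | tri≈ _ x≡y _   = ⊥-elim (adj⇒≢ (choice-adj x) (trans (Fin.toℕ-injective x≡y) (sym cx)))

  choice-2-cycle-fed : ∀ {i} → ¬ Redirects i → ¬ Redirects (choice i) → choice (choice i) ≡ i
    → Fed next i (choice i)
  choice-2-cycle-fed {i} ¬Ri ¬Rci cci with fed? choice i (choice i)
  ... | yes fed = fed-by-choice⇒fed-by-next refl cci fed
  ... | no bare = ⊥-elim ([ ¬Ri , ¬Rci ∘ subst (Redirectable (choice i)) (sym cci) ]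
                           (bare-2-cycle-redirects refl cci bare))

  next-2-cycle-fed : ∀ i → next (next i) ≡ i → Fed next i (next i)
  next-2-cycle-fed i cycle with next-spec i | next-spec (next i)
  ... | inj₁ (Ri , _)         | _                     = redirects⇒fed Ri
  ... | inj₂ _                | inj₁ (Rj , _)         =
    subst (λ y → Fed next y (next i)) cycle (Fed-sym (redirects⇒fed Rj))
  ... | inj₂ (¬Ri , unmovedᵢ) | inj₂ (¬Rj , unmovedⱼ) =
    subst (Fed next i) (sym unmovedᵢ) (choice-2-cycle-fed ¬Ri (¬Rj ∘ subst Redirects (sym unmovedᵢ)) cci)
    where
    cci : choice (choice i) ≡ i
    cci = trans (cong choice (sym unmovedᵢ)) (trans (sym unmovedⱼ) cycle)

module UpperBound {m : ℕ} (G : Graph (suc m))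
  (no-isolated : ¬ HasIsolatedVertex G) (no-K2 : ¬ HasK2Component G) where

  open Edges G
  open Neighbourhoods G

  opaque
    cherry : ∃[ r ] ∃[ p ] ∃[ q ] (adj G r p ≡ true × adj G r q ≡ true × p ≢ q)
    cherry with neighbour no-isolated 0F
    ... | a , 0a with neighbour-besides no-K2 0a
    ...   | inj₁ (z , 0z , z≢a) = 0F , a , z , 0a , 0z , z≢a ∘ sym
    ...   | inj₂ (z , az , z≢0) = a , 0F , z , sym-adj 0a , az , z≢0 ∘ sym

  r p q : Fin (suc m)
  r = proj₁ cherry
  p = proj₁ (proj₂ cherry)
  q = proj₁ (proj₂ (proj₂ cherry))

  rp : adj G r p ≡ true
  rp = proj₁ (proj₂ (proj₂ (proj₂ cherry)))

  rq : adj G r q ≡ true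
  rq = proj₁ (proj₂ (proj₂ (proj₂ (proj₂ cherry))))

  p≢q : p ≢ q
  p≢q = proj₂ (proj₂ (proj₂ (proj₂ (proj₂ cherry))))

  choice : Fin (suc m) → Fin (suc m)
  choice v with v Fin.≟ r | adj G v r Bool.≟ true
  ... | yes _ | _     = p
  ... | no _  | yes _ = r
  ... | no _  | no _  = proj₁ (neighbour no-isolated v)

  choice-adj : ∀ v → adj G v (choice v) ≡ true
  choice-adj v with v Fin.≟ r | adj G v r Bool.≟ true
  ... | yes refl | _      = rp
  ... | no _     | yes vr = vr
  ... | no _     | no _   = proj₂ (neighbour no-isolated v)

  choice-r : choice r ≡ p
  choice-r with r Fin.≟ r
  ... | yes _   = refl
  ... | no r≢r = ⊥-elim (r≢r refl)

  choice-toward-r : ∀ {v} → adj G v r ≡ true → choice v ≡ r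
  choice-toward-r {v} vr with v Fin.≟ r | adj G v r Bool.≟ true
  ... | yes v≡r | _      = ⊥-elim (adj⇒≢ vr v≡r)
  ... | no _    | yes _  = refl
  ... | no _    | no ¬vr = ⊥-elim (¬vr vr)

  open Redirection G no-K2 choice choice-adj

  choice-p : choice p ≡ r
  choice-p = choice-toward-r (sym-adj rp)

  choice-q : choice q ≡ r
  choice-q = choice-toward-r (sym-adj rq)

  q≢r : q ≢ r
  q≢r = adj⇒≢ (sym-adj rq)

  next-r : next r ≡ p
  next-r = trans (fed⇒next≡choice feeder) choice-r
    where
    feeder : Fed choice r (choice r)
    feeder = q , q≢r , subst (q ≢_) (sym choice-r) (p≢q ∘ sym) , inj₁ choice-q

  next-p : next p ≡ r
  next-p = trans (fed⇒next≡choice feeder) choice-p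
    where
    feeder : Fed choice p (choice p)
    feeder = q , p≢q ∘ sym , subst (q ≢_) (sym choice-p) q≢r , inj₂ (trans choice-q (sym choice-p))

  outEdge : Fin (suc m) → Edge G
  outEdge x = edge x (next x) (next-adj x)

  endpoint-outEdgeˡ : ∀ x → endpoint G x (outEdge x)
  endpoint-outEdgeˡ x = endpoint-edge⁺ x (next x) (next-adj x) (inj₁ refl)

  endpoint-outEdgeʳ : ∀ x → endpoint G (next x) (outEdge x)
  endpoint-outEdgeʳ x = endpoint-edge⁺ x (next x) (next-adj x) (inj₂ refl)

  outEdge-r≡outEdge-p : outEdge r ≡ outEdge p
  outEdge-r≡outEdge-p = edge-≡-by-endpoints (outEdge r) (outEdge p) λ w w∈ →
    endpoint-edge⁺ p (next p) (next-adj p)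
      ([ (λ w≡r → inj₂ (trans w≡r (sym next-p))) , (λ w≡nextʳ → inj₁ (trans w≡nextʳ next-r)) ]
        (endpoint-edge⁻ r (next r) (next-adj r) w∈))

  candidates : List (Edge G)
  candidates = map (outEdge ∘ punchIn r) (allFin m)

  chosen : List (Edge G)
  chosen = deduplicate _≟ₑ_ candidates

  outEdge-∈-away-from-r : ∀ {x} → r ≢ x → outEdge x ∈ chosen
  outEdge-∈-away-from-r r≢x = ∈-deduplicate⁺ _≟ₑ_
    (subst (λ z → outEdge z ∈ candidates) (Fin.punchIn-punchOut r≢x)
      (∈-map⁺ (outEdge ∘ punchIn r) (∈-allFin (punchOut r≢x))))

  outEdge-∈ : ∀ x → outEdge x ∈ chosen
  outEdge-∈ x with r Fin.≟ x
  ... | yes refl = subst (_∈ chosen) (sym outEdge-r≡outEdge-p) (outEdge-∈-away-from-r (adj⇒≢ rp))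
  ... | no r≢x   = outEdge-∈-away-from-r r≢x

  S : List (V (middle G))
  S = map inj₂ chosen

  S-unique : Unique S
  S-unique = Unique.map⁺ Sum.inj₂-injective (UniqueDec.deduplicate-! _≟ₑ_ candidates)

  S-length : length S ≤ m
  S-length = begin
    length S           ≡⟨ length-map inj₂ chosen ⟩
    length chosen      ≤⟨ length-deduplicate _≟ₑ_ candidates ⟩
    length candidates  ≡⟨ length-map (outEdge ∘ punchIn r) (allFin m) ⟩
    length (allFin m)  ≡⟨ length-tabulate (λ i → i) ⟩
    m                  ∎
    where open ℕ.≤-Reasoning

  outEdge-dominates : ∀ x e → endpoint G x e → outEdge x ≢ e
    → Adj (middle G) (inj₂ e) (inj₂ (outEdge x))
  outEdge-dominates x e x∈e out≢e = out≢e ∘ sym , x , x∈e , endpoint-outEdgeˡ x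

  next-along : ∀ {x y} e → outEdge x ≡ e → endpoint G x e → endpoint G y e → x ≢ y → next x ≡ y
  next-along {x} e out≡e x∈e y∈e x≢y =
    [ (λ next≡x → ⊥-elim (adj⇒≢ (next-adj x) (sym next≡x))) , (λ next≡y → next≡y) ]
    (endpoint-of-two e (subst (endpoint G (next x)) out≡e (endpoint-outEdgeʳ x)) x∈e y∈e x≢y)

  edge-in-2-cycle-dominated : ∀ e → next (proj₁ (proj₁ e)) ≡ proj₂ (proj₁ e)
    → next (proj₂ (proj₁ e)) ≡ proj₁ (proj₁ e) → ∃[ y ] (y ∈ S × Adj (middle G) (inj₂ e) y)
  edge-in-2-cycle-dominated e@((i , j) , _) nextᵢ nextⱼ
    with next-2-cycle-fed i (trans (cong next nextᵢ) nextⱼ)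
  ... | w , w≢i , w≢nextᵢ , nextw∈ =
    inj₂ (outEdge w) , ∈-map⁺ inj₂ (outEdge-∈ w) , e≢outw , next w
    , subst (λ y → next w ≡ i ⊎ next w ≡ y) nextᵢ nextw∈ , endpoint-outEdgeʳ w
    where
    e≢outw : e ≢ outEdge w
    e≢outw e≡outw = [ w≢i , (λ w≡j → w≢nextᵢ (trans w≡j (sym nextᵢ))) ]
      (subst (endpoint G w) (sym e≡outw) (endpoint-outEdgeˡ w))

  edge-dominated : ∀ e → ∃[ y ] (y ∈ S × Adj (middle G) (inj₂ e) y)
  edge-dominated e@((i , j) , _) with outEdge i ≟ₑ e | outEdge j ≟ₑ e
  ... | no outᵢ≢e | _ =
    inj₂ (outEdge i) , ∈-map⁺ inj₂ (outEdge-∈ i) , outEdge-dominates i e (inj₁ refl) outᵢ≢e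
  ... | yes _ | no outⱼ≢e =
    inj₂ (outEdge j) , ∈-map⁺ inj₂ (outEdge-∈ j) , outEdge-dominates j e (inj₂ refl) outⱼ≢e
  ... | yes outᵢ≡e | yes outⱼ≡e = edge-in-2-cycle-dominated e
    (next-along e outᵢ≡e (inj₁ refl) (inj₂ refl) (endpoints-distinct e))
    (next-along e outⱼ≡e (inj₂ refl) (inj₁ refl) (endpoints-distinct e ∘ sym))

  upper-bound : ∃[ S ] (IsTDS (middle G) S × length S ≤ m)
  upper-bound = S , (S-unique , dominated) , S-length
    where
    dominated : ∀ x → ∃[ y ] (y ∈ S × Adj (middle G) x y)
    dominated (inj₁ v) = inj₂ (outEdge v) , ∈-map⁺ inj₂ (outEdge-∈ v) , endpoint-outEdgeˡ v
    dominated (inj₂ e) = edge-dominated e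

⌈2n/3⌉≤ : ∀ n a → 2 * n ≤ 3 * a → (2 * n + 2) / 3 ≤ a
⌈2n/3⌉≤ n a 2n≤3a = ℕ.≤-pred (m<n*o⇒m/o<n (begin-strict
  2 * n + 2  <⟨ ℕ.+-monoʳ-< (2 * n) (ℕ.n<1+n 2) ⟩
  2 * n + 3  ≤⟨ ℕ.+-monoˡ-≤ 3 2n≤3a ⟩
  3 * a + 3  ≡⟨ trans (ℕ.+-comm (3 * a) 3) (cong (3 +_) (ℕ.*-comm 3 a)) ⟩
  suc a * 3  ∎))
  where open ℕ.≤-Reasoning

γT-middle-bounds : ∀ {m} (G : Graph (suc m)) → ¬ HasIsolatedVertex G → ¬ HasK2Component G
  → ∃[ a ] (IsγT (middle G) a × a ≤ m × (2 * suc m + 2) / 3 ≤ a)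
γT-middle-bounds {m} G no-isolated no-K2 with UpperBound.upper-bound G no-isolated no-K2
... | S₀ , tds₀ , S₀≤m with Edges.γT-exists G tds₀
...   | a , γ@((S , (_ , dominating) , refl) , _) , a≤S₀ =
  a , γ , ℕ.≤-trans a≤S₀ S₀≤m , ⌈2n/3⌉≤ (suc m) a (LowerBound.lower-bound G S dominating)

+-≤-2* : ∀ {a b k} → a ≤ k → b ≤ k → a + b ≤ 2 * k
+-≤-2* {a} {b} {k} a≤k b≤k = subst (a + b ≤_) (cong (k +_) (sym (ℕ.+-identityʳ k))) (ℕ.+-mono-≤ a≤k b≤k)

2*-≤-+ : ∀ {a b k} → k ≤ a → k ≤ b → 2 * k ≤ a + b
2*-≤-+ {a} {b} {k} k≤a k≤b = subst (_≤ a + b) (cong (k +_) (sym (ℕ.+-identityʳ k))) (ℕ.+-mono-≤ k≤a k≤b)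

theorem5p1 : (n : ℕ) → 2 ≤ n → (G : Graph n)
    → ¬ HasIsolatedVertex G → ¬ HasK2Component G
    → ¬ HasIsolatedVertex (complement G) → ¬ HasK2Component (complement G)
    → ∃[ a ] ∃[ b ] (IsγT (middle G) a × IsγT (middle (complement G)) b
        × (a + b ≤ 2 * (n ∸ 1))
        × (2 * ((2 * n + 2) / 3) ≤ a + b)
        × (a * b ≤ (n ∸ 1) * (n ∸ 1))
        × (((2 * n + 2) / 3) * ((2 * n + 2) / 3) ≤ a * b))
theorem5p1 (suc m) _ G no-isolated no-K2 no-isolated′ no-K2′
  with γT-middle-bounds G no-isolated no-K2 | γT-middle-bounds (complement G) no-isolated′ no-K2′
... | a , γa , a≤ , ≤a | b , γb , b≤ , ≤b =
  a , b , γa , γb , +-≤-2* a≤ b≤ , 2*-≤-+ ≤a ≤b , ℕ.*-mono-≤ a≤ b≤ , ℕ.*-mono-≤ ≤a ≤b
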